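{- For every integer $n>3$, there are at least two distinct sequences of legal moves of the Fibonacci Quilt Game on $n$ that each lead from the initial position ($n$ copies of $q_1$) to an FQ-legal decomposition of $n$.
   Context: Let $(q_i)_{i\ge1}$ be the Fibonacci Quilt sequence: $q_1=1,q_2=2,q_3=3,q_4=4$ and $q_i=q_{i-3}+q_{i-2}$ for $i\ge5$. An FQ-legal decomposition of a positive integer $m$ is an expression $m=q_{\ell_1}+\cdots+q_{\ell_t}$ with $\ell_1>\ell_2>\cdots>\ell_t$ such that $|\ell_i-\ell_j|\notin\{1,3,4\}$ for all $i\neq j$ and $\{1,3\}\not\subseteq\{\ell_1,\dots,\ell_t\}$. The Fibonacci Quilt Game on $n$: a position is a finite multiset of terms $q_i$ (recorded by their indices); the initial position is $n$ copies of $q_1$. A move replaces two elements of the current multiset (with multiplicity) by one or two elements according to one of the following rules: (1a) $q_1,q_2\to q_3$; (1b) for $i\ge2$, $q_i,q_{i+1}\to q_{i+3}$; (2a) $q_1,q_5\to q_2,q_4$, allowed only if no other move is possible in the current position; (2b) for $i\ge2$, $q_i,q_{i+4}\to q_{i+5}$; (3a) $q_1,q_1\to q_2$; (3b) $q_2,q_2\to q_4$; (3c) $q_3,q_3\to q_2,q_4$; (3d) $q_4,q_4\to q_1,q_6$ or $q_4,q_4\to q_3,q_5$ (player's choice); (3e) $q_5,q_5\to q_1,q_7$; (3f) $q_6,q_6\to q_2,q_8$ or $q_6,q_6\to q_3,q_7$ (player's choice); (3g) for $i\ge7$, $q_i,q_i\to q_{i-5},q_{i+2}$; (4a) for $i=1,2$,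 $q_i,q_{i+3}\to q_{i+4}$; (4b) $q_3,q_6\to q_1,q_7$; (4c) for $i=4,5$, $q_i,q_{i+3}\to q_1,q_{i+4}$; (4d) $q_6,q_9\to q_2,q_{10}$; (4e) for $i\ge7$, $q_i,q_{i+3}\to q_{i-5},q_{i+4}$; (5) $q_1,q_3\to q_4$. The game ends when no move is possible. -}

module Defs where

open import Data.Nat using (ℕ; zero; suc; _+_; _∸_; _≤_; _<_; ∣_-_∣)
open import Data.List using (List; []; _∷_; _++_; map; replicate)
open import Data.Nat.ListAction using (sum)
open import Data.List.Membership.Propositional using (_∈_)
open import Data.List.Relation.Unary.All using (All)
open import Data.List.Relation.Unary.AllPairs using (AllPairs)
open import Data.List.Relation.Binary.Permutation.Propositional using (_↭_)
open import Data.Product using (Σ; ∃; _×_; _,_)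
open import Relation.Binary.PropositionalEquality using (_≡_; _≢_)
open import Relation.Nullary using (¬_)

-- Fibonacci Quilt sequence (q 0 is an unused dummy value).
q : ℕ → ℕ
q zero = 0
q (suc zero) = 1
q (suc (suc zero)) = 2
q (suc (suc (suc zero))) = 3
q (suc (suc (suc (suc zero)))) = 4
q (suc (suc (suc (suc (suc k))))) = q (suc (suc k)) + q (suc (suc (suc k)))

-- A position: a finite multiset of indices, represented by a list
-- (considered up to permutation).
Position : Set
Position = List ℕ

GoodPair : ℕ → ℕ → Set
GoodPair a b = a ≢ b × ∣ a - b ∣ ≢ 1 × ∣ a - b ∣ ≢ 3 × ∣ a - b ∣ ≢ 4

FQLegal : ℕ → Position → Set
FQLegal m P =
  sum (map q P) ≡ m × All (1 ≤_) P × AllPairs GoodPair P × ¬ (1 ∈ P × 3 ∈ P)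

-- The move rules: Rule a b outs means q_a, q_b → outs.
data Rule : ℕ → ℕ → List ℕ → Set where
  r1a  : Rule 1 2 (3 ∷ [])
  r1b  : ∀ i → 2 ≤ i → Rule i (suc i) (i + 3 ∷ [])
  r2a  : Rule 1 5 (2 ∷ 4 ∷ [])
  r2b  : ∀ i → 2 ≤ i → Rule i (i + 4) (i + 5 ∷ [])
  r3a  : Rule 1 1 (2 ∷ [])
  r3b  : Rule 2 2 (4 ∷ [])
  r3c  : Rule 3 3 (2 ∷ 4 ∷ [])
  r3d₁ : Rule 4 4 (1 ∷ 6 ∷ [])
  r3d₂ : Rule 4 4 (3 ∷ 5 ∷ [])
  r3e  : Rule 5 5 (1 ∷ 7 ∷ [])
  r3f₁ : Rule 6 6 (2 ∷ 8 ∷ [])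
  r3f₂ : Rule 6 6 (3 ∷ 7 ∷ [])
  r3g  : ∀ i → 7 ≤ i → Rule i i (i ∸ 5 ∷ i + 2 ∷ [])
  r4a₁ : Rule 1 4 (5 ∷ [])
  r4a₂ : Rule 2 5 (6 ∷ [])
  r4b  : Rule 3 6 (1 ∷ 7 ∷ [])
  r4c₁ : Rule 4 7 (1 ∷ 8 ∷ [])
  r4c₂ : Rule 5 8 (1 ∷ 9 ∷ [])
  r4d  : Rule 6 9 (2 ∷ 10 ∷ [])
  r4e  : ∀ i → 7 ≤ i → Rule i (i + 3) (i ∸ 5 ∷ i + 4 ∷ [])
  r5   : Rule 1 3 (4 ∷ [])

-- A move is recorded by the two consumed indices and the produced indices.
Move : Set
Move = ℕ × ℕ × List ℕ

Present : Position → ℕ → ℕ → Set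
Present P a b = ∃ λ R → P ↭ (a ∷ b ∷ R)

-- No move other than rule (2a) is possible in P.
OnlyTwoA : Position → Set
OnlyTwoA P = ∀ a b outs → Rule a b outs → Present P a b → (a ≡ 1 × b ≡ 5)

data Step : Position → Move → Position → Set where
  step : ∀ {P P'} a b outs R →
         Rule a b outs →
         (a ≡ 1 → b ≡ 5 → OnlyTwoA P) →
         P ↭ (a ∷ b ∷ R) →
         P' ↭ (outs ++ R) →
         Step P (a , b , outs) P'

data Play : Position → List Move → Position → Set where
  done : ∀ {P} → Play P [] P
  _∷_  : ∀ {P P' P'' m ms} → Step P m P' → Play P' ms P'' → Play P (m ∷ ms) P''

initial : ℕ → Position
initial n = replicate n 1

module Submission where

-- The greedy algorithm gives an FQ-legal decomposition of every n:
-- take the largest q_K ≤ n; for K ≥ 6 the remainder is below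
-- q_{K+1} - q_K = q_{K-4}, so all parts of its decomposition lie at least
-- five indices below K.  For n ≥ 4 the largest part K is at least 4.
-- Every position is reachable from ones: a part q_k (k ≥ 5) is assembled
-- from q_{k-2} + q_{k-3} ones by building the two smaller parts side by
-- side and merging them with rule (1b).  For k ≥ 4 the part q_k has two
-- constructions with different openings: the recursive one begins with
-- 1,1→2 then 1,2→3, an alternative one with 1,1→2 twice.  Building the
-- largest part of the decomposition either way yields the two plays.

open import Defs
open import Data.Nat using (ℕ; zero; suc; _+_; _∸_; _≤_; _<_; z≤n; s≤s; ∣_-_∣)
open import Data.Nat.Properties
open import Data.Nat.Induction using (<-rec)
open import Data.Nat.ListAction using (sum)
open import Data.List using (List; []; _∷_; _++_; map)
open import Data.List.Properties using (++-assoc)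
open import Data.List.Relation.Binary.Permutation.Propositional
  using (_↭_; swap; ↭-refl; ↭-sym; ↭-trans; ↭-reflexive)
open import Data.List.Relation.Binary.Permutation.Propositional.Properties
  using (++⁺ˡ; ++⁺ʳ; shift; shifts)
open import Data.List.Relation.Unary.All as All using (All; []; _∷_)
open import Data.List.Relation.Unary.AllPairs using ([]; _∷_)
open import Data.List.Relation.Unary.Any using (here; there)
open import Data.Product using (Σ; _×_; _,_)
open import Data.Empty using (⊥-elim)
open import Data.Sum using (inj₁; inj₂)
open import Relation.Binary.PropositionalEquality
  using (_≡_; _≢_; refl; sym; trans; cong; subst; module ≡-Reasoning)
open import Relation.Nullary using (¬_)

-- A step by a rule other than (2a).  It has no side condition, so it stays
-- legal when further terms are added to the position.
data FreeStep : Position → Move → Position → Set where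
  fire : ∀ {P P' a b outs} R → Rule a b outs → ¬ (a ≡ 1 × b ≡ 5) →
         P ↭ a ∷ b ∷ R → P' ↭ outs ++ R → FreeStep P (a , b , outs) P'

data FreePlay : Position → List Move → Position → Set where
  finish : ∀ {P P'} → P ↭ P' → FreePlay P [] P'
  _∷_    : ∀ {P P' P'' m ms} → FreeStep P m P' → FreePlay P' ms P'' →
           FreePlay P (m ∷ ms) P''

freeStep⇒Step : ∀ {P m P'} → FreeStep P m P' → Step P m P'
freeStep⇒Step (fire R r not2a src tgt) =
  step _ _ _ R r (λ a≡1 b≡5 → ⊥-elim (not2a (a≡1 , b≡5))) src tgt

-- A nonempty free play is a legal play; the final reordering is absorbed
-- into the target of the last step.
freePlay⇒Play : ∀ {P m ms P'} → FreePlay P (m ∷ ms) P' → Play P (m ∷ ms) P'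
freePlay⇒Play (fire R r not2a src tgt ∷ finish end) =
  freeStep⇒Step (fire R r not2a src (↭-trans (↭-sym end) tgt)) ∷ done
freePlay⇒Play (s ∷ rest@(_ ∷ _)) = freeStep⇒Step s ∷ freePlay⇒Play rest

reorder : ∀ {P Q ms R} → P ↭ Q → FreePlay Q ms R → FreePlay P ms R
reorder p (finish q) = finish (↭-trans p q)
reorder p (fire R r not2a src tgt ∷ rest) = fire R r not2a (↭-trans p src) tgt ∷ rest

apply : ∀ {P a b outs ms Q} R → Rule a b outs → ¬ (a ≡ 1 × b ≡ 5) →
        P ↭ a ∷ b ∷ R → FreePlay (outs ++ R) ms Q → FreePlay P ((a , b , outs) ∷ ms) Q
apply R r not2a src rest = fire R r not2a src ↭-refl ∷ rest

infixr 5 _⟫_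

_⟫_ : ∀ {P ms P' ns P''} → FreePlay P ms P' → FreePlay P' ns P'' → FreePlay P (ms ++ ns) P''
finish p   ⟫ rest = reorder p rest
(s ∷ play) ⟫ rest = s ∷ (play ⟫ rest)

frameʳ : ∀ L {P ms P'} → FreePlay P ms P' → FreePlay (P ++ L) ms (P' ++ L)
frameʳ L (finish p) = finish (++⁺ʳ L p)
frameʳ L (fire {outs = outs} R r not2a src tgt ∷ rest) =
  fire (R ++ L) r not2a (++⁺ʳ L src) (↭-trans (++⁺ʳ L tgt) (↭-reflexive (++-assoc outs R L)))
  ∷ frameʳ L rest

frameˡ : ∀ L {P ms P'} → FreePlay P ms P' → FreePlay (L ++ P) ms (L ++ P')
frameˡ L (finish p) = finish (++⁺ˡ L p)
frameˡ L (fire {a = a} {b = b} {outs = outs} R r not2a src tgt ∷ rest) =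
  fire (L ++ R) r not2a (↭-trans (++⁺ˡ L src) (shifts L (a ∷ b ∷ [])))
                        (↭-trans (++⁺ˡ L tgt) (shifts L outs))
  ∷ frameˡ L rest

parallel : ∀ {P ms P' Q ns Q'} → FreePlay P ms P' → FreePlay Q ns Q' →
           FreePlay (P ++ Q) (ms ++ ns) (P' ++ Q')
parallel {P' = P'} {Q = Q} p q = frameʳ Q p ⟫ frameˡ P' q

initial-+ : ∀ a b → initial (a + b) ≡ initial a ++ initial b
initial-+ zero    b = refl
initial-+ (suc a) b = cong (1 ∷_) (initial-+ a b)

assemble : ∀ {a b ms ns P Q} → FreePlay (initial a) ms P → FreePlay (initial b) ns Q →
           FreePlay (initial (a + b)) (ms ++ ns) (P ++ Q)
assemble {a} {b} p q = reorder (↭-reflexive (initial-+ a b)) (parallel p q)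

mergeConsecutive : ∀ {P} i → 2 ≤ i → P ↭ i ∷ suc i ∷ [] →
                   FreePlay P ((i , suc i , i + 3 ∷ []) ∷ []) (3 + i ∷ [])
mergeConsecutive i 2≤i src =
  apply [] (r1b i 2≤i) (λ { (i≡1 , _) → <⇒≱ (subst (_< 2) (sym i≡1) ≤-refl) 2≤i }) src
    (finish (↭-reflexive (cong (_∷ []) (+-comm i 3))))

merge11 merge12 : Move
merge11 = 1 , 1 , 2 ∷ []
merge12 = 1 , 2 , 3 ∷ []

Opens : Move → List Move → Set
Opens μ ms = Σ (List Move) λ rest → ms ≡ merge11 ∷ μ ∷ rest

opens-++ : ∀ {μ ms} ns → Opens μ ms → Opens μ (ms ++ ns)
opens-++ ns (rest , refl) = rest ++ ns , refl

opens-distinct : ∀ {ms ns} → Opens merge12 ms → Opens merge11 ns → ms ≢ ns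
opens-distinct (_ , refl) (_ , refl) ()

Built : ℕ → Set
Built k = Σ (List Move) λ ms → FreePlay (initial (q k)) ms (k ∷ [])

Construction : Move → ℕ → Set
Construction μ k = Σ (List Move) λ ms → FreePlay (initial (q k)) ms (k ∷ []) × Opens μ ms

-- q_{m+5} = q_{m+2} + q_{m+3}: build the part m+3, then the part m+2, then
-- merge them.  The opening of the first construction is kept.
grow : ∀ {μ} m → Construction μ (3 + m) → Built (2 + m) → Construction μ (5 + m)
grow m (ms , larger , opening) (ns , smaller) =
  _ , reorder (↭-reflexive (cong initial (+-comm (q (2 + m)) (q (3 + m)))))
        (assemble larger smaller ⟫ mergeConsecutive (2 + m) (s≤s (s≤s z≤n)) (swap _ _ ↭-refl))
    , opens-++ _ (opens-++ ns opening)

mutual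
  build : ∀ k → 1 ≤ k → Built k
  build 1 _ = [] , finish ↭-refl
  build 2 _ = _ , apply [] r3a (λ { (_ , ()) }) ↭-refl (finish ↭-refl)
  build (suc (suc (suc m))) _ = forget (build₃ m)
    where
    forget : Construction merge12 (3 + m) → Built (3 + m)
    forget (ms , play , _) = ms , play

  -- For parts k ≥ 3 the recursive construction opens with 1,1→2 and 1,2→3;
  -- the base cases are 111 → 21 → 3 and 1111 → 211 → 31 → 4.
  build₃ : ∀ m → Construction merge12 (3 + m)
  build₃ 0 = _ ,
    apply (1 ∷ []) r3a (λ { (_ , ()) }) ↭-refl
    (apply [] r1a (λ { (_ , ()) }) (swap 2 1 ↭-refl) (finish ↭-refl)) , _ , refl
  build₃ 1 = _ ,
    apply (1 ∷ 1 ∷ []) r3a (λ { (_ , ()) }) ↭-refl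
    (apply (1 ∷ []) r1a (λ { (_ , ()) }) (swap 2 1 ↭-refl)
    (apply [] r5 (λ { (_ , ()) }) (swap 3 1 ↭-refl) (finish ↭-refl))) , _ , refl
  build₃ (suc (suc m)) = grow m (build₃ m) (build (suc (suc m)) (s≤s z≤n))

-- For parts k ≥ 4 a second construction opens with 1,1→2 twice; the base
-- cases are 1111 → 211 → 22 → 4 and 11111 → 2111 → 221 → 32 → 5.
buildAlt : ∀ m → Construction merge11 (4 + m)
buildAlt 0 = _ ,
  apply (1 ∷ 1 ∷ []) r3a (λ { (_ , ()) }) ↭-refl
  (apply (2 ∷ []) r3a (λ { (_ , ()) }) (↭-sym (shift 2 (1 ∷ 1 ∷ []) []))
  (apply [] r3b (λ { (() , _) }) ↭-refl (finish ↭-refl))) , _ , refl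
buildAlt 1 = _ ,
  apply (1 ∷ 1 ∷ 1 ∷ []) r3a (λ { (_ , ()) }) ↭-refl
  (apply (2 ∷ 1 ∷ []) r3a (λ { (_ , ()) }) (↭-sym (shift 2 (1 ∷ 1 ∷ []) (1 ∷ [])))
  (apply (2 ∷ []) r1a (λ { (_ , ()) }) (shift 1 (2 ∷ 2 ∷ []) [])
  (mergeConsecutive 2 ≤-refl (swap 3 2 ↭-refl)))) , _ , refl
buildAlt (suc (suc m)) = grow (suc m) (buildAlt m) (build (suc (suc (suc m))) (s≤s z≤n))

buildAll : ∀ P → All (1 ≤_) P → Σ (List Move) λ ms → FreePlay (initial (sum (map q P))) ms P
buildAll []      []       = [] , finish ↭-refl
buildAll (k ∷ P) (h ∷ hs) with build k h | buildAll P hs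
... | ms , part | ns , rest = ms ++ ns , assemble part rest

playFrom : ∀ {μ n k P} → Construction μ k → All (1 ≤_) P → q k + sum (map q P) ≡ n →
           Σ (List Move) λ ms → Play (initial n) ms (k ∷ P) × Opens μ ms
playFrom {P = P} (ms , part , rest , refl) hs refl with buildAll P hs
... | ns , others = _ , freePlay⇒Play (assemble part others) , opens-++ ns (rest , refl)

q-increasing : ∀ i → q i < q (suc i)
q-increasing 0 = s≤s z≤n
q-increasing 1 = s≤s (s≤s z≤n)
q-increasing 2 = s≤s (s≤s (s≤s z≤n))
q-increasing 3 = s≤s (s≤s (s≤s (s≤s z≤n)))
q-increasing 4 = s≤s (s≤s (s≤s (s≤s (s≤s z≤n))))
q-increasing (suc (suc (suc (suc (suc m))))) =
  subst (_< q (3 + m) + q (4 + m)) (+-comm (q (3 + m)) (q (2 + m)))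
        (+-monoʳ-< (q (3 + m)) (<-trans (q-increasing (suc (suc m))) (q-increasing (suc (suc (suc m))))))

q-monotone : ∀ {i j} → i ≤ j → q i ≤ q j
q-monotone {i} i≤j with m≤n⇒∃[o]m+o≡n i≤j
... | d , refl = climb d
  where
  climb : ∀ d → q i ≤ q (i + d)
  climb zero    = ≤-reflexive (cong q (sym (+-identityʳ i)))
  climb (suc d) = ≤-trans (climb d)
                          (subst (q (i + d) ≤_) (cong q (sym (+-suc i d))) (<⇒≤ (q-increasing (i + d))))

q-reflects-< : ∀ {i j} → q i < q j → i < j
q-reflects-< {i} {j} qi<qj = ≰⇒> (λ j≤i → <⇒≱ qi<qj (q-monotone j≤i))

-- q_{K+1} = q_K + q_{K-4} for K ≥ 6: the gap the greedy remainder lives in.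
q-gap : ∀ m → q (7 + m) ≡ q (6 + m) + q (2 + m)
q-gap m = rearrange (q (4 + m)) (q (2 + m)) (q (3 + m))
  where
  rearrange : ∀ a b c → a + (b + c) ≡ (c + a) + b
  rearrange a b c = begin
    a + (b + c)  ≡⟨ cong (a +_) (+-comm b c) ⟩
    a + (c + b)  ≡⟨ +-assoc a c b ⟨
    (a + c) + b  ≡⟨ cong (_+ b) (+-comm a c) ⟩
    (c + a) + b  ∎
    where open ≡-Reasoning

greedyIndex : ∀ n → 1 ≤ n → Σ ℕ λ k → Σ ℕ λ r → q k + r ≡ n × q k + r < q (suc k)
greedyIndex (suc zero) _ = 1 , 0 , refl , s≤s (s≤s z≤n)
greedyIndex (suc (suc n)) _ with greedyIndex (suc n) (s≤s z≤n)
... | k , r , eq , below with m≤n⇒m<n∨m≡n below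
... | inj₁ stillBelow = k , suc r , trans (+-suc (q k) r) (cong suc eq) ,
                        subst (_< q (suc k)) (sym (+-suc (q k) r)) stillBelow
... | inj₂ reached    = suc k , 0 , trans (+-identityʳ _) (trans (sym reached) (cong suc eq)) ,
                        subst (_< q (suc (suc k))) (sym (+-identityʳ _)) (q-increasing (suc k))

greedySplit : ∀ n → 7 ≤ n → Σ ℕ λ m → Σ ℕ λ r → q (6 + m) + r ≡ n × r < q (2 + m)
greedySplit n 7≤n with greedyIndex n (≤-trans (s≤s z≤n) 7≤n)
... | k , r , eq , below with m≤n⇒∃[o]m+o≡n {6} {k} (index≥6 (subst (_< q (suc k)) eq below))
  where
  -- q_6 = 7 ≤ n < q_{k+1} forces k ≥ 6.
  index≥6 : ∀ {k} → n < q (suc k) → 6 ≤ k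
  index≥6 n<q = ≤-pred (q-reflects-< (≤-<-trans 7≤n n<q))
... | m , refl = m , r , eq , +-cancelˡ-< (q (6 + m)) r _ (subst (q (6 + m) + r <_) (q-gap m) below)

partsBelowSum : ∀ P → All (λ i → q i ≤ sum (map q P)) P
partsBelowSum []      = []
partsBelowSum (k ∷ P) = m≤m+n (q k) _ ∷ All.map (λ h → ≤-trans h (m≤n+m _ (q k))) (partsBelowSum P)

farApart : ∀ {i j} → 5 + i ≤ j → GoodPair j i
farApart {i} {j} 5+i≤j with atLeast5 (subst (5 ≤_) (sym distance) (m+n≤o⇒m≤o∸n 5 5+i≤j))
  where
  distance : ∣ j - i ∣ ≡ j ∸ i
  distance = trans (∣-∣-comm j i) (m≤n⇒∣m-n∣≡n∸m (m+n≤o⇒n≤o 5 5+i≤j))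

  atLeast5 : ∀ {d} → 5 ≤ d → d ≢ 0 × d ≢ 1 × d ≢ 3 × d ≢ 4
  atLeast5 (s≤s (s≤s (s≤s (s≤s (s≤s _))))) = (λ ()) , (λ ()) , (λ ()) , (λ ())
... | ≢0 , ≢1 , ≢3 , ≢4 = (λ j≡i → ≢0 (m≡n⇒∣m-n∣≡0 j≡i)) , ≢1 , ≢3 , ≢4

prependLarge : ∀ m {r P} → r < q (2 + m) → FQLegal r P → FQLegal (q (6 + m) + r) (6 + m ∷ P)
prependLarge m {P = P} r<gap (total , positive , pairs , no13) =
  cong (q (6 + m) +_) total ,
  s≤s z≤n ∷ positive ,
  All.map (λ qi≤sum → farApart (farBelow qi≤sum)) (partsBelowSum P) ∷ pairs ,
  λ { (here () , _) ; (_ , here ()) ; (there one , there three) → no13 (one , three) }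
  where
  farBelow : ∀ {i} → q i ≤ sum (map q P) → 5 + i ≤ 6 + m
  farBelow {i} qi≤sum = +-monoʳ-≤ 5 (≤-pred i<2+m)
    where
    i<2+m : i < 2 + m
    i<2+m = q-reflects-< (≤-<-trans (subst (q i ≤_) total qi≤sum) r<gap)

single : ∀ k → 1 ≤ k → FQLegal (q k) (k ∷ [])
single k 1≤k = +-identityʳ (q k) , 1≤k ∷ [] , [] ∷ [] ,
  λ { (here refl , here ()) ; (_ , there ()) ; (there () , _) }

LargeHead : Position → Set
LargeHead P = Σ ℕ λ k → Σ Position λ P' → P ≡ k ∷ P' × 4 ≤ k

Decomposition : ℕ → Set
Decomposition n = Σ Position λ P → FQLegal n P × (4 ≤ n → LargeHead P)

greedyLarge : ∀ n → 7 ≤ n → (∀ {r} → r < n → Decomposition r) → Decomposition n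
greedyLarge n 7≤n smaller with greedySplit n 7≤n
... | m , r , refl , r<gap with smaller (m<n+m r (q-monotone {1} {6 + m} (s≤s z≤n)))
... | P , legal , _ =
  6 + m ∷ P , prependLarge m r<gap legal , λ _ → 6 + m , P , refl , s≤s (s≤s (s≤s (s≤s z≤n)))

decompose : ∀ n → Decomposition n
decompose = <-rec Decomposition greedy
  where
  greedy : ∀ n → (∀ {r} → r < n → Decomposition r) → Decomposition n
  greedy 0 _ = [] , (refl , [] , [] , λ { (() , _) }) , λ ()
  greedy 1 _ = 1 ∷ [] , single 1 (s≤s z≤n) , λ { (s≤s ()) }
  greedy 2 _ = 2 ∷ [] , single 2 (s≤s z≤n) , λ { (s≤s (s≤s ())) }
  greedy 3 _ = 3 ∷ [] , single 3 (s≤s z≤n) , λ { (s≤s (s≤s (s≤s ()))) }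
  greedy 4 _ = 4 ∷ [] , single 4 (s≤s z≤n) , λ _ → 4 , [] , refl , ≤-refl
  greedy 5 _ = 5 ∷ [] , single 5 (s≤s z≤n) , λ _ → 5 , [] , refl , n≤1+n 4
  greedy 6 _ =
    4 ∷ 2 ∷ [] ,
    (refl , s≤s z≤n ∷ s≤s z≤n ∷ [] , (((λ ()) , (λ ()) , (λ ()) , (λ ())) ∷ []) ∷ [] ∷ [] ,
     λ { (here () , _) ; (there (here ()) , _) ; (there (there ()) , _) }) ,
    λ _ → 4 , _ , refl , ≤-refl
  greedy n@(suc (suc (suc (suc (suc (suc (suc x))))))) smaller = greedyLarge n (m≤m+n 7 x) smaller

-- Decompose n greedily; its first part 4 + m is built either by the
-- recursive construction or by the alternative one, and the rest of the
-- decomposition is built the same way in both plays.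
lemma2p4 : (n : ℕ) → 3 < n →
    Σ (List Move) λ ms₁ → Σ (List Move) λ ms₂ → Σ Position λ P₁ → Σ Position λ P₂ →
    ms₁ ≢ ms₂ × Play (initial n) ms₁ P₁ × FQLegal n P₁ × Play (initial n) ms₂ P₂ × FQLegal n P₂
lemma2p4 n 4≤n with decompose n
... | _ , legal , large with large 4≤n
... | k , rest , refl , 4≤k with legal | m≤n⇒∃[o]m+o≡n {4} {k} 4≤k
... | total , _ ∷ positive , _ | m , refl
  with playFrom (build₃ (suc m)) positive total | playFrom (buildAlt m) positive total
... | ms₁ , play₁ , opens₁ | ms₂ , play₂ , opens₂ =
  ms₁ , ms₂ , _ , _ , opens-distinct opens₁ opens₂ , play₁ , legal , play₂ , legal
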